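{- Let $(F,L,l)$ be an instance of the 2-ASLASAT problem and let $C=(l_1\vee l_2)$ be a clause of $F$ reachable from $\neg L$, with $l_1$ the main literal of $C$ with respect to $(F,L,l)$. Then $l_1$ is not a second literal of $C$ with respect to any walk of $F$ starting from $\neg L$ and including $C$.
   Context: A literal is a Boolean variable or its negation; $\neg$ denotes negation, and for a set $L$ of literals $\neg L=\{\neg l': l'\in L\}$. $Var(\cdot)$ denotes the set of variables. A 2-CNF formula $F$ is a conjunction of clauses each consisting of exactly two literals (a one-literal clause $(l)$ is written $(l\vee l)$; $(l_1\vee l_2)$ and $(l_2\vee l_1)$ are the same clause), with pairwise distinct clauses. A set of literals is non-contradictory if it contains no literal and its negation. A satisfying assignment of $F$ is a non-contradictory set $P$ of literals with $Var(P)=Var(F)$ such that each clause of $F$ contains a literal of $P$. $SWRT(F,L)$ means $F$ has a satisfying assignment $P$ with $P\cap \neg L=\emptyset$. An instance of the 2-ASLASAT problem is a triple $(F,L,l)$ with $F$ such a 2-CNF formula, $L$ a non-contradictory set of literals with $SWRT(F,L)$ true, and $l$ a literal with $Var(l)\notin Var(L)$. A walk of $F$ is a nonempty sequence $(C_1,\dots,C_q)$ of (not necessarily distinct) clauses of $F$ where in each entry one literal is designated first and the other second, such that for $i<q$ the second literal of $C_i$ is the negation of the first literal of $C_{i+1}$; it starts from (is from) a set $M$ if the first literal of $C_1$ lies in $M$. For a clause $C$ and walk $w$, a literal of $C$ is a first (resp. second) literal of $C$ with respect to $w$ if it is the designated first (resp. second) literal of some entry $C_i$ of $w$ with $C_i=C$.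 A clause $C$ of $F$ is reachable from $\neg L$ if some walk $w$ of $F$ from $\neg L$ includes $C$; a literal $l_1$ of $C$ that is a first literal of $C$ with respect to such a walk $w$ is called the main literal of $C$ with respect to $(F,L,l)$. -}

module Defs where

open import Data.Nat using (ℕ)
open import Data.Bool using (Bool; true; false; not)
open import Data.Product using (Σ; _×_; _,_; proj₁; proj₂)
open import Data.Sum using (_⊎_)
open import Data.List using (List; []; _∷_; map; concatMap)
open import Data.List.Membership.Propositional using (_∈_)
open import Data.List.Relation.Unary.All using (All)
open import Data.List.Relation.Unary.Any using (Any)
open import Data.List.Relation.Unary.AllPairs using (AllPairs)
open import Data.Empty using (⊥)
open import Relation.Nullary using (¬_)
open import Relation.Binary.PropositionalEquality using (_≡_)

-- Boolean variables are indexed by natural numbers.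
-- A literal is a variable together with a polarity (true = positive).
record Lit : Set where
  constructor lit
  field
    var  : ℕ
    sign : Bool
open Lit public

¬ˡ_ : Lit → Lit
¬ˡ lit v s = lit v (not s)

negSet : List Lit → List Lit
negSet L = map ¬ˡ_ L

varsOf : List Lit → List ℕ
varsOf L = map var L

-- A clause (l₁ ∨ l₂) is written as an ordered pair; (l ∨ l) is a one-literal clause.
Clause : Set
Clause = Lit × Lit

SameClause : Clause → Clause → Set
SameClause (a , b) (c , d) = (a ≡ c × b ≡ d) ⊎ (a ≡ d × b ≡ c)

Formula : Set
Formula = List Clause

DistinctClauses : Formula → Set
DistinctClauses F = AllPairs (λ C D → ¬ SameClause C D) F

_∈F_ : Clause → Formula → Set
C ∈F F = Any (SameClause C) F

varsF : Formula → List ℕ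
varsF F = concatMap (λ C → var (proj₁ C) ∷ var (proj₂ C) ∷ []) F

NonContradictory : List Lit → Set
NonContradictory P = ∀ x → x ∈ P → ¬ (¬ˡ x ∈ P)

Satisfies : Formula → List Lit → Set
Satisfies F P =
  NonContradictory P
  × (∀ v → v ∈ varsOf P → v ∈ varsF F)
  × (∀ v → v ∈ varsF F → v ∈ varsOf P)
  × All (λ C → proj₁ C ∈ P ⊎ proj₂ C ∈ P) F

SWRT : Formula → List Lit → Set
SWRT F L = Σ (List Lit) λ P → Satisfies F P × (∀ x → x ∈ P → ¬ (x ∈ negSet L))

Instance : Formula → List Lit → Lit → Set
Instance F L l =
  DistinctClauses F × NonContradictory L × SWRT F L × ¬ (var l ∈ varsOf L)

-- An entry of a walk: (designated first literal, designated second literal)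
Entry : Set
Entry = Lit × Lit

data Linked : List Entry → Set where
  linked-[] : Linked []
  linked-[_] : ∀ e → Linked (e ∷ [])
  linked-∷ : ∀ e e′ es → proj₂ e ≡ ¬ˡ (proj₁ e′) → Linked (e′ ∷ es) → Linked (e ∷ e′ ∷ es)

NonEmpty : List Entry → Set
NonEmpty [] = ⊥
NonEmpty (_ ∷ _) = Data.Unit.⊤
  where import Data.Unit

IsWalk : Formula → List Entry → Set
IsWalk F w = NonEmpty w × All (λ e → e ∈F F) w × Linked w

StartsFrom : List Lit → List Entry → Set
StartsFrom M [] = ⊥
StartsFrom M (e ∷ _) = proj₁ e ∈ M

Includes : Clause → List Entry → Set
Includes C w = Any (λ e → SameClause e C) w

FirstLitWrt : Clause → List Entry → Lit → Set
FirstLitWrt C w x = Any (λ e → SameClause e C × proj₁ e ≡ x) w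

SecondLitWrt : Clause → List Entry → Lit → Set
SecondLitWrt C w x = Any (λ e → SameClause e C × proj₂ e ≡ x) w

Reachable : Formula → List Lit → Clause → Set
Reachable F L C = Σ (List Entry) λ w → IsWalk F w × StartsFrom (negSet L) w × Includes C w

MainLiteral : Formula → List Lit → Lit → Clause → Lit → Set
MainLiteral F L l C x =
  Σ (List Entry) λ w → IsWalk F w × StartsFrom (negSet L) w × Includes C w × FirstLitWrt C w x

module Submission where

-- Fix a satisfying assignment P of F that avoids ¬L (it exists
-- because SWRT(F, L) holds).  Call an entry (a , b) of a walk *forced* by P
-- when ¬a ∈ P and b ∈ P.  We show that every entry of every walk of F that
-- starts from ¬L is forced:
--   * the first literal a of the first entry lies in ¬L, so a ∉ P; since P
--     assigns every variable of F, it must contain ¬a;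
--   * if ¬a ∈ P for an entry (a , b), then a ∉ P, so the clause (a ∨ b),
--     being satisfied by P, has b ∈ P; the next entry starts with ¬b, whose
--     negation b is in P, so the property propagates along the walk.
-- Consequently the main literal l₁, being a first literal of C in some walk
-- from ¬L, satisfies ¬l₁ ∈ P, while a second occurrence of l₁ in another walk
-- from ¬L would give l₁ ∈ P — contradicting that P is non-contradictory.

open import Defs
open import Data.Bool using (true; false)
open import Data.Product using (_×_; _,_; proj₁; proj₂)
open import Data.Sum using (_⊎_; inj₁; inj₂)
open import Data.Empty using (⊥-elim)
open import Data.List using (List; []; _∷_)
open import Data.List.Membership.Propositional using (_∈_)
open import Data.List.Membership.Propositional.Properties using (∈-map⁻)
open import Data.List.Relation.Unary.All using (All; []; _∷_; head; lookupAny)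
open import Data.List.Relation.Unary.Any as Any using (here; there)
open import Relation.Nullary using (¬_)
open import Relation.Binary.PropositionalEquality using (_≡_; refl; subst)

negation-assigned : ∀ {P : List Lit} (x z : Lit) →
  var x ≡ var z → z ∈ P → ¬ (x ∈ P) → ¬ˡ x ∈ P
negation-assigned (lit v true)  (lit .v true)  refl z∈P x∉P = ⊥-elim (x∉P z∈P)
negation-assigned (lit v true)  (lit .v false) refl z∈P x∉P = z∈P
negation-assigned (lit v false) (lit .v true)  refl z∈P x∉P = z∈P
negation-assigned (lit v false) (lit .v false) refl z∈P x∉P = ⊥-elim (x∉P z∈P)

first-var∈varsF : ∀ F (e : Clause) → e ∈F F → var (proj₁ e) ∈ varsF F
first-var∈varsF (D ∷ F) e (here (inj₁ (refl , _))) = here refl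
first-var∈varsF (D ∷ F) e (here (inj₂ (refl , _))) = there (here refl)
first-var∈varsF (D ∷ F) e (there e∈F)               = there (there (first-var∈varsF F e e∈F))

satisfied-SameClause : ∀ {P : List Lit} (e D : Clause) → SameClause e D →
  proj₁ D ∈ P ⊎ proj₂ D ∈ P → proj₁ e ∈ P ⊎ proj₂ e ∈ P
satisfied-SameClause e D (inj₁ (refl , refl)) sat      = sat
satisfied-SameClause e D (inj₂ (refl , refl)) (inj₁ s) = inj₂ s
satisfied-SameClause e D (inj₂ (refl , refl)) (inj₂ s) = inj₁ s

module _ (F : Formula) (P : List Lit) (P-sat : Satisfies F P) where

  private
    P-consistent : NonContradictory P
    P-consistent = proj₁ P-sat

    P-covers : ∀ v → v ∈ varsF F → v ∈ varsOf P
    P-covers = proj₁ (proj₂ (proj₂ P-sat))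

    P-satisfies : All (λ C → proj₁ C ∈ P ⊎ proj₂ C ∈ P) F
    P-satisfies = proj₂ (proj₂ (proj₂ P-sat))

  Forced : Entry → Set
  Forced e = (¬ˡ proj₁ e ∈ P) × (proj₂ e ∈ P)

  clause-satisfied : ∀ e → e ∈F F → proj₁ e ∈ P ⊎ proj₂ e ∈ P
  clause-satisfied e e∈F with lookupAny P-satisfies e∈F
  ... | sat , same = satisfied-SameClause e (Any.lookup e∈F) same sat

  forced-entry : ∀ e → e ∈F F → ¬ˡ proj₁ e ∈ P → Forced e
  forced-entry e e∈F ¬a∈P with clause-satisfied e e∈F
  ... | inj₁ a∈P = ⊥-elim (P-consistent _ a∈P ¬a∈P)
  ... | inj₂ b∈P = ¬a∈P , b∈P

  forced-propagates : ∀ e es → All (_∈F F) (e ∷ es) → Linked (e ∷ es) →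
    ¬ˡ proj₁ e ∈ P → All Forced (e ∷ es)
  forced-propagates e [] (e∈F ∷ []) _ ¬a∈P = forced-entry e e∈F ¬a∈P ∷ []
  forced-propagates e (e′ ∷ es) (e∈F ∷ es∈F) (linked-∷ _ _ _ b≡¬a′ lk) ¬a∈P =
    forced ∷ forced-propagates e′ es es∈F lk (subst (_∈ P) b≡¬a′ (proj₂ forced))
    where forced = forced-entry e e∈F ¬a∈P

  absent-falsified : ∀ e → e ∈F F → ¬ (proj₁ e ∈ P) → ¬ˡ proj₁ e ∈ P
  absent-falsified e e∈F a∉P with ∈-map⁻ var (P-covers _ (first-var∈varsF F e e∈F))
  ... | z , z∈P , var≡ = negation-assigned (proj₁ e) z var≡ z∈P a∉P

  walk-forced : ∀ L → (∀ x → x ∈ P → ¬ (x ∈ negSet L)) →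
    ∀ w → IsWalk F w → StartsFrom (negSet L) w → All Forced w
  walk-forced L P-avoids (e ∷ es) (_ , es∈F , lk) a∈¬L =
    forced-propagates e es es∈F lk
      (absent-falsified e (head es∈F) (λ a∈P → P-avoids _ a∈P a∈¬L))

corollary2 : (F : Formula) (L : List Lit) (l : Lit) → Instance F L l →
    (l₁ l₂ : Lit) → (l₁ , l₂) ∈F F → Reachable F L (l₁ , l₂) →
    MainLiteral F L l (l₁ , l₂) l₁ →
    (w : List Entry) → IsWalk F w → StartsFrom (negSet L) w → Includes (l₁ , l₂) w →
    ¬ SecondLitWrt (l₁ , l₂) w l₁
corollary2 F L l (_ , _ , (P , P-sat , P-avoids) , _) l₁ l₂ _ _
           (w₀ , w₀-walk , w₀-start , _ , l₁-first) w w-walk w-start _ l₁-second =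
  proj₁ P-sat l₁ l₁∈P ¬l₁∈P
  where
  ¬l₁∈P : ¬ˡ l₁ ∈ P
  ¬l₁∈P with lookupAny (walk-forced F P P-sat L P-avoids w₀ w₀-walk w₀-start) l₁-first
  ... | (¬a∈P , _) , (_ , a≡l₁) = subst (λ x → ¬ˡ x ∈ P) a≡l₁ ¬a∈P

  l₁∈P : l₁ ∈ P
  l₁∈P with lookupAny (walk-forced F P P-sat L P-avoids w w-walk w-start) l₁-second
  ... | (_ , b∈P) , (_ , b≡l₁) = subst (_∈ P) b≡l₁ b∈P
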